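{- Let $p$ be a two-colored partition and let $\alpha,\beta,\gamma$ be points of $p$. Then (a) $\delta_p(\alpha,\alpha)\equiv 0 \pmod{\Sigma(p)}$; (b) $\delta_p(\alpha,\beta)\equiv -\delta_p(\beta,\alpha)\pmod{\Sigma(p)}$; (c) $\delta_p(\alpha,\gamma)\equiv \delta_p(\alpha,\beta)+\delta_p(\beta,\gamma)\pmod{\Sigma(p)}$.
   Context: A two-colored partition $p$ consists of two disjoint, possibly empty, finite totally ordered sets $R_L$ (lower row) and $R_U$ (upper row), a decomposition of the set of points $P_p=R_L\cup R_U$ into disjoint nonempty subsets called blocks, and a coloring assigning to each point one of the colors $\circ$ (white) or $\bullet$ (black). The orientation of $p$ is the cyclic order on $P_p$ which agrees with the order of $R_L$ on $R_L$, agrees with the reverse of the order of $R_U$ on $R_U$, in which the maximum of $R_U$ is the successor of the maximum of $R_L$, and the minimum of $R_L$ is the successor of the minimum of $R_U$. For distinct points $\alpha\neq\beta$, the intervals $]\alpha,\beta[_p$, $]\alpha,\beta]_p$ etc. are taken with respect to this cyclic order (e.g. $]\alpha,\beta]_p$ is the set of points met when moving from $\alpha$ (excluded) along the cyclic order up to $\beta$ (included)). The normalized color of a lower point is its color; the normalized color of an upper point is the inverse of its color. For $S\subseteq P_p$, the color sum $\sigma_p(S)$ is the number of points of $S$ of normalized color $\circ$ minus the number of points of $S$ of normalized color $\bullet$; the total color sum is $\Sigma(p)=\sigma_p(P_p)$. The color distance is $\delta_p(\alpha,\beta)=\Sigma(p)$ if $\alpha=\beta$; $\delta_p(\alpha,\beta)=\sigma_p(]\alpha,\beta[_p)$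 if $\alpha\neq\beta$ have different normalized colors; $\delta_p(\alpha,\beta)=\sigma_p(]\alpha,\beta]_p)$ if $\alpha\neq\beta$ have the same normalized color. Congruence modulo $0$ means equality. -}

module Defs where

open import Data.Nat as ℕ using (ℕ; _≤ᵇ_; _<ᵇ_)
open import Data.Fin using (Fin; toℕ)
open import Data.Fin.Properties using () renaming (_≟_ to _≟ᶠ_)
open import Data.Sum using (_⊎_; inj₁; inj₂)
open import Data.Sum.Properties using (≡-dec)
open import Data.Bool using (Bool; true; false; if_then_else_; _∧_)
open import Data.Integer as ℤ using (ℤ; +_; -_; _-_)
open import Data.Integer.Divisibility using (_∣_)
open import Data.List using (List; map; allFin; _++_; foldr)
open import Relation.Nullary using (yes; no)
open import Relation.Binary.PropositionalEquality using (_≡_)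

data Color : Set where
  white black : Color

inv : Color → Color
inv white = black
inv black = white

_==ᶜ_ : Color → Color → Bool
white ==ᶜ white = true
black ==ᶜ black = true
_     ==ᶜ _     = false

-- Lower row R_L = Fin nL, upper row R_U = Fin nU,
-- both with their natural total orders.  Points are  Fin nL ⊎ Fin nU
-- (inj₁ = lower, inj₂ = upper).  Blocks are the (nonempty) fibres of the
-- labelling  block ; color assigns ∘/• to each point.
record TwoColoredPartition : Set where
  field
    nL    : ℕ
    nU    : ℕ
    block : Fin nL ⊎ Fin nU → ℕ
    color : Fin nL ⊎ Fin nU → Color

open TwoColoredPartition public

Point : TwoColoredPartition → Set
Point p = Fin (nL p) ⊎ Fin (nU p)

ncolor : (p : TwoColoredPartition) → Point p → Color
ncolor p (inj₁ i) = color p (inj₁ i)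
ncolor p (inj₂ j) = inv (color p (inj₂ j))

-- Orientation: position of a point in the cyclic order, as 0 .. nL+nU-1.
-- Lower points in increasing order, then upper points in decreasing order
-- (max of R_U follows max of R_L; min of R_L follows min of R_U).
size : TwoColoredPartition → ℕ
size p = nL p ℕ.+ nU p

pos : (p : TwoColoredPartition) → Point p → ℕ
pos p (inj₁ i) = toℕ i
pos p (inj₂ j) = nL p ℕ.+ (nU p ℕ.∸ 1 ℕ.∸ toℕ j)

offset : (p : TwoColoredPartition) → Point p → Point p → ℕ
offset p α γ =
  if pos p α ≤ᵇ pos p γ
  then pos p γ ℕ.∸ pos p α
  else (size p ℕ.+ pos p γ) ℕ.∸ pos p α

-- interval membership (for α ≠ β)
-- γ ∈ ]α,β[_p
inOpen : (p : TwoColoredPartition) → Point p → Point p → Point p → Bool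
inOpen p α β γ = (0 <ᵇ offset p α γ) ∧ (offset p α γ <ᵇ offset p α β)

inHalfOpen : (p : TwoColoredPartition) → Point p → Point p → Point p → Bool
inHalfOpen p α β γ = (0 <ᵇ offset p α γ) ∧ (offset p α γ ≤ᵇ offset p α β)

allPoints : (p : TwoColoredPartition) → List (Point p)
allPoints p = map inj₁ (allFin (nL p)) ++ map inj₂ (allFin (nU p))

colorValue : Color → ℤ
colorValue white = + 1
colorValue black = - (+ 1)

sumℤ : List ℤ → ℤ
sumℤ = foldr ℤ._+_ (+ 0)

σ : (p : TwoColoredPartition) → (Point p → Bool) → ℤ
σ p S = sumℤ (map (λ x → if S x then colorValue (ncolor p x) else + 0) (allPoints p))

Σ : TwoColoredPartition → ℤ
Σ p = σ p (λ _ → true)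

_≟ₚ_ : {p : TwoColoredPartition} → (α β : Point p) → Relation.Nullary.Dec (α ≡ β)
_≟ₚ_ = ≡-dec _≟ᶠ_ _≟ᶠ_

δ : (p : TwoColoredPartition) → Point p → Point p → ℤ
δ p α β with _≟ₚ_ {p} α β
... | yes _ = Σ p
... | no _  = if ncolor p α ==ᶜ ncolor p β
              then σ p (inHalfOpen p α β)
              else σ p (inOpen p α β)

-- congruence modulo m in ℤ (modulo 0 means equality)
_≡_[mod_] : ℤ → ℤ → ℤ → Set
x ≡ y [mod m ] = m ∣ (x - y)

-- Number the points 0, …, size p − 1 along the orientation and let T x be the color sum of the
-- points numbered at most x.  For α ≠ β, the interval ]α,β] together with the points up to α is
-- the set of points up to β, counted once more in full when the interval passes from the last
-- point back to the first; so σ ]α,β] ≡ T β − T α modulo Σ p.  The open interval ]α,β[ misses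
-- only β, and when α and β have different normalized colors the color value of β equals
-- [β white] − [α white].  Hence with the potential φ x = T x − [x white] every color distance
-- satisfies δ α β ≡ φ β − φ α modulo Σ p (for α = β, δ α α = Σ p), and (a)–(c) are the usual
-- identities for differences of a potential.

module Submission where

open import Defs
open import Data.Product using (_×_)
open import Data.Integer using (+_; -_; _+_)

open import Algebra.Properties.CommutativeSemigroup using (interchange)
open import Data.Bool using (Bool; true; false; if_then_else_; _∧_; T)
open import Data.Empty using (⊥-elim)
open import Data.Fin using (Fin; toℕ; opposite)
open import Data.Fin.Properties using (toℕ<n; toℕ-injective; opposite-prop; opposite-involutive)
open import Data.Integer using (ℤ; _-_; _*_)
open import Data.Integer.Divisibility.Signed using (_∣_; divides; ∣-refl; ∣⇒∣ᵤ; ∣m∣n⇒∣m+n; ∣m∣n⇒∣m-n)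
import Data.Integer.Properties as ℤ
open import Data.Integer.Tactic.RingSolver using (solve-∀)
open import Data.List using (List; []; _∷_; map)
open import Data.List.Membership.Propositional using (_∈_)
open import Data.List.Membership.Propositional.Properties using (∈-map⁺; ∈-map⁻; ∈-++⁺ˡ; ∈-++⁺ʳ; ∈-allFin)
open import Data.List.Properties using (map-cong)
open import Data.List.Relation.Binary.Disjoint.Propositional using (Disjoint)
open import Data.List.Relation.Unary.All as All using (All; []; _∷_)
open import Data.List.Relation.Unary.Any using (here; there)
open import Data.List.Relation.Unary.Unique.Propositional using (Unique; _∷_)
open import Data.List.Relation.Unary.Unique.Propositional.Properties using (map⁺; ++⁺; allFin⁺)
open import Data.Nat as ℕ using (ℕ; _≤_; _<_; _∸_; _≤ᵇ_; _<ᵇ_; _≡ᵇ_; _≤?_; _<?_; _≟_)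
open import Data.Nat.Properties
open import Data.Product using (_,_)
open import Data.Sum using (inj₁; inj₂)
open import Data.Sum.Properties using (inj₁-injective; inj₂-injective)
open import Function.Base using (_∘_)
open import Function.Bundles using (mk⇔)
open import Relation.Binary.Definitions using (tri<; tri≈; tri>)
open import Relation.Binary.PropositionalEquality
open import Relation.Nullary using (Dec; yes; no)
open import Relation.Nullary.Decidable using (dec-true; dec-false; does-⇔)

iverson : Bool → ℕ
iverson true  = 1
iverson false = 0

o≤m⇒o≤n⇒m∸o≤n∸o⇒m≤n : ∀ {m n o} → o ≤ m → o ≤ n → m ∸ o ≤ n ∸ o → m ≤ n
o≤m⇒o≤n⇒m∸o≤n∸o⇒m≤n {m} {n} {o} o≤m o≤n le = begin
  m           ≡⟨ m∸n+n≡m o≤m ⟨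
  m ∸ o ℕ.+ o ≤⟨ +-monoˡ-≤ o le ⟩
  n ∸ o ℕ.+ o ≡⟨ m∸n+n≡m o≤n ⟩
  n           ∎
  where open ≤-Reasoning

∸-cancelʳ-≤ᵇ : ∀ {a x y} → a ≤ x → a ≤ y → (x ∸ a ≤ᵇ y ∸ a) ≡ (x ≤ᵇ y)
∸-cancelʳ-≤ᵇ {a} {x} {y} a≤x a≤y =
  does-⇔ (mk⇔ (o≤m⇒o≤n⇒m∸o≤n∸o⇒m≤n a≤x a≤y) (∸-monoˡ-≤ a)) (x ∸ a ≤? y ∸ a) (x ≤? y)

+-cancelˡ-≤ᵇ : ∀ N {x y} → (N ℕ.+ x ≤ᵇ N ℕ.+ y) ≡ (x ≤ᵇ y)
+-cancelˡ-≤ᵇ N {x} {y} = does-⇔ (mk⇔ (+-cancelˡ-≤ N x y) (+-monoʳ-≤ N)) (N ℕ.+ x ≤? N ℕ.+ y) (x ≤? y)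

iverson-≤ᵇ+<ᵇ≡1 : ∀ x y → iverson (x ≤ᵇ y) ℕ.+ iverson (y <ᵇ x) ≡ 1
iverson-≤ᵇ+<ᵇ≡1 x y with x ≤? y
... | yes x≤y rewrite dec-true (x ≤? y) x≤y | dec-false (y <? x) (≤⇒≯ x≤y) = refl
... | no x≰y rewrite dec-false (x ≤? y) x≰y | dec-true (y <? x) (≰⇒> x≰y) = refl

-- offset, inHalfOpen and inOpen of Defs on bare positions:
-- offset p α γ is cyclicOffset (size p) (pos p α) (pos p γ).
cyclicOffset : ℕ → ℕ → ℕ → ℕ
cyclicOffset N a x = if a ≤ᵇ x then x ∸ a else (N ℕ.+ x) ∸ a

inCyclicHalfOpen inCyclicOpen : ℕ → ℕ → ℕ → ℕ → Bool
inCyclicHalfOpen N a b x = (0 <ᵇ cyclicOffset N a x) ∧ (cyclicOffset N a x ≤ᵇ cyclicOffset N a b)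
inCyclicOpen     N a b x = (0 <ᵇ cyclicOffset N a x) ∧ (cyclicOffset N a x <ᵇ cyclicOffset N a b)

cyclicOffset-≥ : ∀ N {a x} → a ≤ x → cyclicOffset N a x ≡ x ∸ a
cyclicOffset-≥ N {a} {x} a≤x rewrite dec-true (a ≤? x) a≤x = refl

cyclicOffset-< : ∀ N {a x} → x < a → cyclicOffset N a x ≡ (N ℕ.+ x) ∸ a
cyclicOffset-< N {a} {x} x<a rewrite dec-false (a ≤? x) (<⇒≱ x<a) = refl

iverson-inCyclicHalfOpen : ∀ {N a b x} → a < N → b < N → x < N → a ≢ b →
  iverson (inCyclicHalfOpen N a b x) ℕ.+ iverson (x ≤ᵇ a) ≡ iverson (x ≤ᵇ b) ℕ.+ iverson (b <ᵇ a)
iverson-inCyclicHalfOpen {N} {a} {b} {x} a<N b<N x<N a≢b with <-cmp a x | <-cmp a b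
... | tri≈ _ refl _ | _
  rewrite cyclicOffset-≥ N (≤-refl {a}) | n∸n≡0 a | dec-true (a ≤? a) ≤-refl
  = sym (iverson-≤ᵇ+<ᵇ≡1 a b)
... | _ | tri≈ _ a≡b _ = ⊥-elim (a≢b a≡b)
... | tri< a<x _ _ | tri< a<b _ _
  rewrite cyclicOffset-≥ N (<⇒≤ a<x) | cyclicOffset-≥ N (<⇒≤ a<b)
        | dec-true (0 <? x ∸ a) (m<n⇒0<n∸m a<x) | ∸-cancelʳ-≤ᵇ (<⇒≤ a<x) (<⇒≤ a<b)
        | dec-false (x ≤? a) (<⇒≱ a<x) | dec-false (b <? a) (<⇒≯ a<b) = refl
... | tri< a<x _ _ | tri> _ _ b<a
  rewrite cyclicOffset-≥ N (<⇒≤ a<x) | cyclicOffset-< N b<a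
        | dec-true (0 <? x ∸ a) (m<n⇒0<n∸m a<x)
        | dec-true (x ∸ a ≤? N ℕ.+ b ∸ a) (∸-monoˡ-≤ a (m≤n⇒m≤n+o b (<⇒≤ x<N)))
        | dec-false (x ≤? a) (<⇒≱ a<x) | dec-false (x ≤? b) (<⇒≱ (<-trans b<a a<x))
        | dec-true (b <? a) b<a = refl
... | tri> _ _ x<a | tri< a<b _ _
  rewrite cyclicOffset-< N x<a | cyclicOffset-≥ N (<⇒≤ a<b)
        | dec-true (0 <? N ℕ.+ x ∸ a) (m<n⇒0<n∸m (m≤n⇒m≤n+o x a<N))
        | dec-false (N ℕ.+ x ∸ a ≤? b ∸ a) (<⇒≱ (∸-monoˡ-< (m≤n⇒m≤n+o x b<N) (<⇒≤ a<b)))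
        | dec-true (x ≤? a) (<⇒≤ x<a) | dec-true (x ≤? b) (<⇒≤ (<-trans x<a a<b))
        | dec-false (b <? a) (<⇒≯ a<b) = refl
... | tri> _ _ x<a | tri> _ _ b<a
  rewrite cyclicOffset-< N x<a | cyclicOffset-< N b<a
        | dec-true (0 <? N ℕ.+ x ∸ a) (m<n⇒0<n∸m (m≤n⇒m≤n+o x a<N))
        | ∸-cancelʳ-≤ᵇ (m≤n⇒m≤n+o x (<⇒≤ a<N)) (m≤n⇒m≤n+o b (<⇒≤ a<N))
        | +-cancelˡ-≤ᵇ N {x} {b}
        | dec-true (x ≤? a) (<⇒≤ x<a) | dec-true (b <? a) b<a = refl

module _ {N a : ℕ} (a<N : a < N) where

  cyclicOffset-injective : ∀ {x y} → x < N → y < N →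
                           cyclicOffset N a x ≡ cyclicOffset N a y → x ≡ y
  cyclicOffset-injective {x} {y} x<N y<N eq with a ≤? x | a ≤? y
  ... | yes a≤x | yes a≤y
    rewrite cyclicOffset-≥ N a≤x | cyclicOffset-≥ N a≤y = ∸-cancelʳ-≡ a≤x a≤y eq
  ... | no a≰x | no a≰y
    rewrite cyclicOffset-< N (≰⇒> a≰x) | cyclicOffset-< N (≰⇒> a≰y)
    = +-cancelˡ-≡ N x y (∸-cancelʳ-≡ (m≤n⇒m≤n+o x (<⇒≤ a<N)) (m≤n⇒m≤n+o y (<⇒≤ a<N)) eq)
  ... | yes a≤x | no a≰y
    rewrite cyclicOffset-≥ N a≤x | cyclicOffset-< N (≰⇒> a≰y)
    = ⊥-elim (<-irrefl eq (∸-monoˡ-< (m≤n⇒m≤n+o y x<N) a≤x))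
  ... | no a≰x | yes a≤y
    rewrite cyclicOffset-< N (≰⇒> a≰x) | cyclicOffset-≥ N a≤y
    = ⊥-elim (<-irrefl (sym eq) (∸-monoˡ-< (m≤n⇒m≤n+o x y<N) a≤y))

  cyclicOffset-positive : ∀ {b} → a ≢ b → 0 < cyclicOffset N a b
  cyclicOffset-positive {b} a≢b with <-cmp a b
  ... | tri< a<b _ _ rewrite cyclicOffset-≥ N (<⇒≤ a<b) = m<n⇒0<n∸m a<b
  ... | tri≈ _ a≡b _ = ⊥-elim (a≢b a≡b)
  ... | tri> _ _ b<a rewrite cyclicOffset-< N b<a = m<n⇒0<n∸m (m≤n⇒m≤n+o b a<N)

  iverson-inCyclicHalfOpen-endpoint : ∀ {b x} → b < N → x < N → a ≢ b →
    iverson (inCyclicHalfOpen N a b x) ≡ iverson (inCyclicOpen N a b x) ℕ.+ iverson (x ≡ᵇ b)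
  iverson-inCyclicHalfOpen-endpoint {b} {x} b<N x<N a≢b with x ≟ b
  ... | yes refl
    rewrite dec-true (0 <? cyclicOffset N a x) (cyclicOffset-positive a≢b)
          | dec-true (cyclicOffset N a x ≤? cyclicOffset N a x) ≤-refl
          | dec-false (cyclicOffset N a x <? cyclicOffset N a x) (n≮n _)
          | dec-true (x ≟ x) refl = refl
  ... | no x≢b
    rewrite does-⇔ (mk⇔ (λ le → ≤∧≢⇒< le (x≢b ∘ cyclicOffset-injective x<N b<N)) <⇒≤)
                   (cyclicOffset N a x ≤? cyclicOffset N a b) (cyclicOffset N a x <? cyclicOffset N a b)
          | dec-false (x ≟ b) x≢b = sym (+-identityʳ _)

module _ {A : Set} where

  sumℤ-map-+ : ∀ (f g : A → ℤ) xs →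
               sumℤ (map (λ x → f x + g x) xs) ≡ sumℤ (map f xs) + sumℤ (map g xs)
  sumℤ-map-+ f g []       = refl
  sumℤ-map-+ f g (x ∷ xs) = begin
    (f x + g x) + sumℤ (map (λ x → f x + g x) xs)
      ≡⟨ cong (λ s → (f x + g x) + s) (sumℤ-map-+ f g xs) ⟩
    (f x + g x) + (sumℤ (map f xs) + sumℤ (map g xs))
      ≡⟨ interchange ℤ.+-commutativeSemigroup (f x) (g x) _ _ ⟩
    (f x + sumℤ (map f xs)) + (g x + sumℤ (map g xs))
      ∎
    where open ≡-Reasoning

  sumℤ-map-zero : ∀ {f : A → ℤ} {xs} → All (λ x → f x ≡ + 0) xs → sumℤ (map f xs) ≡ + 0
  sumℤ-map-zero []             = refl
  sumℤ-map-zero (fx≡0 ∷ fxs≡0) rewrite fx≡0 | sumℤ-map-zero fxs≡0 = refl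

  sumℤ-map-supported : ∀ {f : A → ℤ} {x xs} → Unique xs → x ∈ xs → (∀ y → y ≢ x → f y ≡ + 0) →
                       sumℤ (map f xs) ≡ f x
  sumℤ-map-supported {f} {x} {x ∷ ys} (x≢ys ∷ _) (here refl) f≡0 =
    trans (cong (λ s → f x + s) (sumℤ-map-zero (All.map (λ x≢y → f≡0 _ (x≢y ∘ sym)) x≢ys)))
          (ℤ.+-identityʳ (f x))
  sumℤ-map-supported {f} {x} {y ∷ ys} (y≢ys ∷ unique) (there x∈ys) f≡0 =
    begin
      f y + sumℤ (map f ys)   ≡⟨ cong (_+ sumℤ (map f ys)) (f≡0 y y≢x) ⟩
      + 0 + sumℤ (map f ys)   ≡⟨ ℤ.+-identityˡ _ ⟩
      sumℤ (map f ys)         ≡⟨ sumℤ-map-supported unique x∈ys f≡0 ⟩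
      f x                     ∎
    where
    open ≡-Reasoning
    y≢x : y ≢ x
    y≢x refl = All.lookup y≢ys x∈ys refl

isWhite : Color → ℤ
isWhite white = + 1
isWhite black = + 0

colorValue-jump : ∀ cα cβ → (if cα ==ᶜ cβ then + 0 else colorValue cβ) ≡ isWhite cβ - isWhite cα
colorValue-jump white white = refl
colorValue-jump white black = refl
colorValue-jump black white = refl
colorValue-jump black black = refl

if-weight : ∀ b (w : ℤ) → (if b then w else + 0) ≡ + iverson b * w
if-weight true  w = sym (ℤ.*-identityˡ w)
if-weight false w = refl

if-weight-+ : ∀ a b (w : ℤ) →
  (if a then w else + 0) + (if b then w else + 0) ≡ + (iverson a ℕ.+ iverson b) * w
if-weight-+ a b w = begin
  (if a then w else + 0) + (if b then w else + 0) ≡⟨ cong₂ _+_ (if-weight a w) (if-weight b w) ⟩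
  + iverson a * w + + iverson b * w               ≡⟨ ℤ.*-distribʳ-+ w (+ iverson a) (+ iverson b) ⟨
  (+ iverson a + + iverson b) * w                 ≡⟨ cong (_* w) (ℤ.pos-+ (iverson a) (iverson b)) ⟨
  + (iverson a ℕ.+ iverson b) * w                 ∎
  where open ≡-Reasoning

if-then-minus : ∀ b {s o w : ℤ} → s ≡ o + w → (if b then s else o) ≡ s - (if b then + 0 else w)
if-then-minus true  {s}         _ = sym (ℤ.+-identityʳ s)
if-then-minus false {o = o} {w} refl = sym (o+w-w≡o o w)
  where
  o+w-w≡o : ∀ o w → (o + w) - w ≡ o
  o+w-w≡o = solve-∀

upperPos≡opposite : ∀ {n} (j : Fin n) → n ∸ 1 ∸ toℕ j ≡ toℕ (opposite j)
upperPos≡opposite {n} j = trans (∸-+-assoc n 1 (toℕ j)) (sym (opposite-prop j))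

inj₁-inj₂-disjoint : ∀ {A B : Set} {xs : List A} {ys : List B} →
                     Disjoint (map inj₁ xs) (map inj₂ ys)
inj₁-inj₂-disjoint (v∈ˡ , v∈ʳ) with ∈-map⁻ inj₁ v∈ˡ | ∈-map⁻ inj₂ v∈ʳ
... | _ , _ , refl | _ , _ , ()

module PotentialDifference {X : Set} {n : ℤ} (d : X → X → ℤ) (φ : X → ℤ)
                           (n∣d-Δφ : ∀ x y → n ∣ d x y - (φ y - φ x)) where

  diagonal : ∀ x → d x x ≡ + 0 [mod n ]
  diagonal x = ∣⇒∣ᵤ (subst (n ∣_) (rearrange (d x x) (φ x)) (n∣d-Δφ x x))
    where
    rearrange : ∀ a f → a - (f - f) ≡ a - + 0
    rearrange = solve-∀

  antisymmetric : ∀ x y → d x y ≡ - d y x [mod n ]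
  antisymmetric x y =
    ∣⇒∣ᵤ (subst (n ∣_) (rearrange (d x y) (d y x) (φ x) (φ y)) (∣m∣n⇒∣m+n (n∣d-Δφ x y) (n∣d-Δφ y x)))
    where
    rearrange : ∀ a b f g → (a - (g - f)) + (b - (f - g)) ≡ a - - b
    rearrange = solve-∀

  additive : ∀ x y z → d x z ≡ d x y + d y z [mod n ]
  additive x y z =
    ∣⇒∣ᵤ (subst (n ∣_) (rearrange (d x z) (d x y) (d y z) (φ x) (φ y) (φ z))
                       (∣m∣n⇒∣m-n (n∣d-Δφ x z) (∣m∣n⇒∣m+n (n∣d-Δφ x y) (n∣d-Δφ y z))))
    where
    rearrange : ∀ a b c f g h → (a - (h - f)) - ((b - (g - f)) + (c - (h - g))) ≡ a - (b + c)
    rearrange = solve-∀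

module _ (p : TwoColoredPartition) where

  weight : Point p → ℤ
  weight x = colorValue (ncolor p x)

  pos-upper : ∀ j → pos p (inj₂ j) ≡ nL p ℕ.+ toℕ (opposite j)
  pos-upper j = cong (nL p ℕ.+_) (upperPos≡opposite j)

  pos<size : ∀ x → pos p x < size p
  pos<size (inj₁ i) = m≤n⇒m≤n+o (nU p) (toℕ<n i)
  pos<size (inj₂ j) rewrite pos-upper j = +-monoʳ-< (nL p) (toℕ<n (opposite j))

  pos-injective : ∀ {x y} → pos p x ≡ pos p y → x ≡ y
  pos-injective {inj₁ i} {inj₁ j} eq = cong inj₁ (toℕ-injective eq)
  pos-injective {inj₁ i} {inj₂ j} eq = ⊥-elim (<-irrefl eq (m≤n⇒m≤n+o _ (toℕ<n i)))
  pos-injective {inj₂ i} {inj₁ j} eq = ⊥-elim (<-irrefl (sym eq) (m≤n⇒m≤n+o _ (toℕ<n j)))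
  pos-injective {inj₂ i} {inj₂ j} eq
    rewrite pos-upper i | pos-upper j = cong inj₂ (begin
      i                       ≡⟨ opposite-involutive i ⟨
      opposite (opposite i)   ≡⟨ cong opposite (toℕ-injective (+-cancelˡ-≡ (nL p) _ _ eq)) ⟩
      opposite (opposite j)   ≡⟨ opposite-involutive j ⟩
      j                       ∎)
    where open ≡-Reasoning

  allPoints-unique : Unique (allPoints p)
  allPoints-unique = ++⁺ (map⁺ inj₁-injective (allFin⁺ (nL p)))
                         (map⁺ inj₂-injective (allFin⁺ (nU p)))
                         inj₁-inj₂-disjoint

  ∈-allPoints : ∀ x → x ∈ allPoints p
  ∈-allPoints (inj₁ i) = ∈-++⁺ˡ (∈-map⁺ inj₁ (∈-allFin i))
  ∈-allPoints (inj₂ j) = ∈-++⁺ʳ _ (∈-map⁺ inj₂ (∈-allFin j))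

  σ-additive : ∀ {A B C D} →
               (∀ x → iverson (A x) ℕ.+ iverson (B x) ≡ iverson (C x) ℕ.+ iverson (D x)) →
               σ p A + σ p B ≡ σ p C + σ p D
  σ-additive {A} {B} {C} {D} eq = begin
    σ p A + σ p B
      ≡⟨ sumℤ-map-+ (indicator A) (indicator B) (allPoints p) ⟨
    sumℤ (map (λ x → indicator A x + indicator B x) (allPoints p))
      ≡⟨ cong sumℤ (map-cong pointwise (allPoints p)) ⟩
    sumℤ (map (λ x → indicator C x + indicator D x) (allPoints p))
      ≡⟨ sumℤ-map-+ (indicator C) (indicator D) (allPoints p) ⟩
    σ p C + σ p D
      ∎
    where
    open ≡-Reasoning
    indicator : (Point p → Bool) → Point p → ℤ
    indicator S x = if S x then weight x else + 0
    pointwise : ∀ x → indicator A x + indicator B x ≡ indicator C x + indicator D x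
    pointwise x = begin
      indicator A x + indicator B x          ≡⟨ if-weight-+ (A x) (B x) (weight x) ⟩
      + (iverson (A x) ℕ.+ iverson (B x)) * weight x ≡⟨ cong (λ k → + k * weight x) (eq x) ⟩
      + (iverson (C x) ℕ.+ iverson (D x)) * weight x ≡⟨ if-weight-+ (C x) (D x) (weight x) ⟨
      indicator C x + indicator D x          ∎

  σ-false : σ p (λ _ → false) ≡ + 0
  σ-false = sumℤ-map-zero (All.universal (λ _ → refl) (allPoints p))

  σ-singleton : ∀ {S} x → (∀ y → T (S y) → y ≡ x) → T (S x) → σ p S ≡ weight x
  σ-singleton {S} x only-x Sx =
    trans (sumℤ-map-supported allPoints-unique (∈-allPoints x) vanishes) (at-x Sx)
    where
    vanishes : ∀ y → y ≢ x → (if S y then weight y else + 0) ≡ + 0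
    vanishes y y≢x with S y | only-x y
    ... | true  | y≡x = ⊥-elim (y≢x (y≡x _))
    ... | false | _   = refl
    at-x : T (S x) → (if S x then weight x else + 0) ≡ weight x
    at-x _ with S x
    ... | true = refl

  prefix : Point p → ℤ
  prefix x = σ p (λ γ → pos p γ ≤ᵇ pos p x)

  wraps : Point p → Point p → Bool
  wraps α β = pos p β <ᵇ pos p α

  σ-inHalfOpen : ∀ {α β} → α ≢ β →
                 σ p (inHalfOpen p α β) + prefix α ≡ prefix β + σ p (λ _ → wraps α β)
  σ-inHalfOpen {α} {β} α≢β = σ-additive λ γ →
    iverson-inCyclicHalfOpen (pos<size α) (pos<size β) (pos<size γ) (α≢β ∘ pos-injective)

  σ-inHalfOpen-endpoint : ∀ {α β} → α ≢ β → σ p (inHalfOpen p α β) ≡ σ p (inOpen p α β) + weight β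
  σ-inHalfOpen-endpoint {α} {β} α≢β = begin
    σ p (inHalfOpen p α β)                              ≡⟨ ℤ.+-identityʳ _ ⟨
    σ p (inHalfOpen p α β) + + 0                        ≡⟨ cong (λ t → σ p (inHalfOpen p α β) + t) σ-false ⟨
    σ p (inHalfOpen p α β) + σ p (λ _ → false)          ≡⟨ σ-additive endpoint ⟩
    σ p (inOpen p α β) + σ p (λ γ → pos p γ ≡ᵇ pos p β) ≡⟨ cong (λ t → σ p (inOpen p α β) + t) at-β ⟩
    σ p (inOpen p α β) + weight β                       ∎
    where
    open ≡-Reasoning
    endpoint : ∀ γ → iverson (inHalfOpen p α β γ) ℕ.+ 0 ≡
                     iverson (inOpen p α β γ) ℕ.+ iverson (pos p γ ≡ᵇ pos p β)
    endpoint γ = trans (+-identityʳ _)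
      (iverson-inCyclicHalfOpen-endpoint (pos<size α) (pos<size β) (pos<size γ) (α≢β ∘ pos-injective))
    only-β : ∀ γ → T (pos p γ ≡ᵇ pos p β) → γ ≡ β
    only-β γ = pos-injective ∘ ≡ᵇ⇒≡ (pos p γ) (pos p β)
    at-β : σ p (λ γ → pos p γ ≡ᵇ pos p β) ≡ weight β
    at-β = σ-singleton β only-β (≡⇒≡ᵇ (pos p β) (pos p β) refl)

  potential : Point p → ℤ
  potential x = prefix x - isWhite (ncolor p x)

  δ-≢ : ∀ {α β} → α ≢ β →
        δ p α β ≡ (if ncolor p α ==ᶜ ncolor p β then σ p (inHalfOpen p α β) else σ p (inOpen p α β))
  δ-≢ {α} {β} α≢β with _≟ₚ_ {p} α β
  ... | yes α≡β = ⊥-elim (α≢β α≡β)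
  ... | no _    = refl

  δ-sub-potential : ∀ {α β} → α ≢ β → δ p α β - (potential β - potential α) ≡ σ p (λ _ → wraps α β)
  δ-sub-potential {α} {β} α≢β = begin
    δ p α β - (potential β - potential α)
      ≡⟨ cong (_- (potential β - potential α)) (trans (δ-≢ α≢β) open-as-halfOpen) ⟩
    (s - (if cα ==ᶜ cβ then + 0 else weight β)) - (potential β - potential α)
      ≡⟨ cong (λ j → (s - j) - (potential β - potential α)) (colorValue-jump cα cβ) ⟩
    (s - (isWhite cβ - isWhite cα)) - ((prefix β - isWhite cβ) - (prefix α - isWhite cα))
      ≡⟨ jumps-cancel s (prefix α) (prefix β) (isWhite cα) (isWhite cβ) ⟩
    (s + prefix α) - prefix β
      ≡⟨ cong (_- prefix β) (σ-inHalfOpen α≢β) ⟩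
    (prefix β + σ p (λ _ → wraps α β)) - prefix β
      ≡⟨ add-sub-cancel (prefix β) (σ p (λ _ → wraps α β)) ⟩
    σ p (λ _ → wraps α β) ∎
    where
    open ≡-Reasoning
    s = σ p (inHalfOpen p α β)
    cα = ncolor p α
    cβ = ncolor p β
    open-as-halfOpen : (if cα ==ᶜ cβ then s else σ p (inOpen p α β)) ≡
                       s - (if cα ==ᶜ cβ then + 0 else weight β)
    open-as-halfOpen = if-then-minus (cα ==ᶜ cβ) (σ-inHalfOpen-endpoint α≢β)
    jumps-cancel : ∀ s a b i j → (s - (j - i)) - ((b - j) - (a - i)) ≡ (s + a) - b
    jumps-cancel = solve-∀
    add-sub-cancel : ∀ b k → (b + k) - b ≡ k
    add-sub-cancel = solve-∀

  Σ∣σ-const : ∀ b → Σ p ∣ σ p (λ _ → b)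
  Σ∣σ-const true  = ∣-refl
  Σ∣σ-const false = subst (Σ p ∣_) (sym σ-false) (divides (+ 0) refl)

  δ-diagonal : ∀ α → δ p α α ≡ Σ p
  δ-diagonal α with _≟ₚ_ {p} α α
  ... | yes _   = refl
  ... | no α≢α  = ⊥-elim (α≢α refl)

  Σ∣δ-sub-potential : ∀ α β → Σ p ∣ δ p α β - (potential β - potential α)
  -- A with on α ≟ₚ β would also rewrite the δ p α β of the goal, so split on a Dec argument.
  Σ∣δ-sub-potential α β = by-cases (_≟ₚ_ {p} α β)
    where
    sub-self-cancel : ∀ x f → x - (f - f) ≡ x
    sub-self-cancel = solve-∀
    by-cases : Dec (α ≡ β) → Σ p ∣ δ p α β - (potential β - potential α)
    by-cases (yes refl) =
      subst (Σ p ∣_) (sym (trans (sub-self-cancel (δ p α α) (potential α)) (δ-diagonal α))) ∣-refl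
    by-cases (no α≢β)   = subst (Σ p ∣_) (sym (δ-sub-potential α≢β)) (Σ∣σ-const (wraps α β))

lemma3p1 : (p : TwoColoredPartition) (α β γ : Point p) →
    (δ p α α ≡ + 0 [mod Σ p ])
    × (δ p α β ≡ - δ p β α [mod Σ p ])
    × (δ p α γ ≡ δ p α β + δ p β γ [mod Σ p ])
lemma3p1 p α β γ = diagonal α , antisymmetric α β , additive α β γ
  where open PotentialDifference (δ p) (potential p) (Σ∣δ-sub-potential p)
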